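{- Let $\Delta$ be a finite abstract simplicial complex and $\Delta'$ a subcomplex of $\Delta$. If $\Delta$ $\mathrm{LC}$-reduces to $\Delta'$, then $\Delta$ $\mathrm{NE}$-reduces to $\Delta'$; in particular, $\Delta$ collapses to $\Delta'$.
   Context: $[k]=\{1,\dots,k\}$. For a simplicial complex $\Delta$ with vertex set $V$, a facet is a maximal face and $\mathcal{F}(v)$ is the set of facets containing the vertex $v$. For $\kappa\colon V\to[k]$ and a face $S$, $S_\kappa$ is the multiset on $[k]$ with $S_\kappa(t)=|\{v\in S:\kappa(v)=t\}|$; for multisets $\|M\|=\sum_tM(t)$ and $(M\cap M')(t)=\min(M(t),M'(t))$. A $k$-linear coloring is a surjective $\kappa\colon V\to[k]$ with $\|F_\kappa\cap F'_\kappa\|=|F\cap F'|$ for all facets $F,F'$. A representative subcomplex with respect to $\kappa$ is a subcomplex $\{S\in\Delta:S\subseteq W\}$ induced on a set $W\subseteq V$ containing exactly one vertex of each color, such that $\mathcal{F}(x)\subseteq\mathcal{F}(y)$ whenever $x\in V$, $y\in W$, $\kappa(x)=\kappa(y)$. $\Delta$ $\mathrm{LC}$-reduces to $\Delta'$ if there is a sequence $\Delta=\Delta_0\supseteq\Delta_1\supseteq\dots\supseteq\Delta_t=\Delta'$ such that for each $0\le r\le t-1$, $\Delta_{r+1}$ is a representative subcomplex of $\Delta_r$ with respect to some linear coloring of $\Delta_r$ (on the vertex set of $\Delta_r$). For a vertex $v$: $\mathrm{del}_\Delta(v)=\{S\in\Delta:v\notin S\}$, $\mathrm{lk}_\Delta(v)=\{S\in\Delta:v\notin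 S,\ S\cup\{v\}\in\Delta\}$. Nonevasiveness is defined inductively: a one-point complex is nonevasive, and $\Delta$ is nonevasive if it has a vertex $v$ with $\mathrm{del}_\Delta(v)$ and $\mathrm{lk}_\Delta(v)$ both nonevasive. $\Delta$ $\mathrm{NE}$-reduces to $\Delta'$ if there are subcomplexes $\Delta=\Delta^1,\Delta^2,\dots,\Delta^{t+1}=\Delta'$ and vertices $v_1,\dots,v_t$ with $\Delta^{r+1}=\mathrm{del}_{\Delta^r}(v_r)$ (so $V(\Delta^r)=V(\Delta^{r+1})\cup\{v_r\}$) and $\mathrm{lk}_{\Delta^r}(v_r)$ nonevasive for all $1\le r\le t$. A face $S$ is free if it is not maximal and lies in a unique maximal face; removing all faces containing a free face $S$ is an elementary collapse; $\Delta$ collapses to $\Delta'$ if $\Delta'$ is obtained from $\Delta$ by a sequence of elementary collapses. -}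

module Defs where

open import Data.Bool using (Bool; true; false; T; _∧_; not)
open import Data.Nat using (ℕ; _⊓_)
open import Data.Fin using (Fin; _≟_)
open import Data.Fin.Subset using (Subset; _∈_; _∉_; _⊆_; ⁅_⁆; _∪_; _∩_; ∣_∣; ⊥)
open import Data.Fin.Subset.Properties using (_⊆?_; _∈?_)
open import Data.Vec using (tabulate)
open import Data.List using (List; map; allFin)
open import Data.Nat.ListAction using (sum)
open import Data.Product using (Σ; _×_; ∃; ∃-syntax)
open import Relation.Nullary using (¬_; ⌊_⌋)
open import Relation.Binary.PropositionalEquality using (_≡_)
open import Function.Bundles using (_⇔_)

-- A (finite abstract) simplicial complex on the ground set Fin n is given
-- by its (decidable) family of faces, as a Boolean predicate on subsets.
Complex : ℕ → Set
Complex n = Subset n → Bool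

module _ {n : ℕ} where

  _∈Δ_ : Subset n → Complex n → Set
  S ∈Δ Δ = T (Δ S)

  record IsComplex (Δ : Complex n) : Set where
    field
      empty-face : ⊥ ∈Δ Δ
      down-closed : ∀ {S S′} → S ⊆ S′ → S′ ∈Δ Δ → S ∈Δ Δ

  _⊑_ : Complex n → Complex n → Set
  Δ′ ⊑ Δ = ∀ S → S ∈Δ Δ′ → S ∈Δ Δ

  _≋_ : Complex n → Complex n → Set
  Δ ≋ Δ′ = ∀ S → Δ S ≡ Δ′ S

  IsVertex : Complex n → Fin n → Set
  IsVertex Δ v = ⁅ v ⁆ ∈Δ Δ

  Facet : Complex n → Subset n → Set
  Facet Δ F = F ∈Δ Δ × (∀ G → G ∈Δ Δ → F ⊆ G → G ≡ F)

  del : Complex n → Fin n → Complex n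
  del Δ v S = Δ S ∧ not ⌊ v ∈? S ⌋

  lk : Complex n → Fin n → Complex n
  lk Δ v S = not ⌊ v ∈? S ⌋ ∧ Δ (S ∪ ⁅ v ⁆)

  OnePoint : Complex n → Set
  OnePoint Δ = ∃[ v ] (∀ S → (S ∈Δ Δ) ⇔ (S ⊆ ⁅ v ⁆))

  data NonEvasive (Δ : Complex n) : Set where
    point : OnePoint Δ → NonEvasive Δ
    step  : (v : Fin n) → IsVertex Δ v →
            NonEvasive (del Δ v) → NonEvasive (lk Δ v) → NonEvasive Δ

  data NEReduces (Δ : Complex n) (Δ′ : Complex n) : Set where
    done : Δ ≋ Δ′ → NEReduces Δ Δ′
    step : (v : Fin n) → IsVertex Δ v → NonEvasive (lk Δ v) →
           NEReduces (del Δ v) Δ′ → NEReduces Δ Δ′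

  Free : Complex n → Subset n → Set
  Free Δ S = S ∈Δ Δ × ¬ Facet Δ S ×
             (∃[ F ] (Facet Δ F × S ⊆ F × (∀ G → Facet Δ G → S ⊆ G → G ≡ F)))

  collapse : Complex n → Subset n → Complex n
  collapse Δ S T′ = Δ T′ ∧ not ⌊ S ⊆? T′ ⌋

  data Collapses (Δ : Complex n) (Δ′ : Complex n) : Set where
    done : Δ ≋ Δ′ → Collapses Δ Δ′
    step : (S : Subset n) → Free Δ S →
           Collapses (collapse Δ S) Δ′ → Collapses Δ Δ′

  -- colorings κ : V → [k], represented on the ground set Fin n (only the
  -- values on V(Δ) matter); colors are Fin k ≅ [k]
  module _ {k : ℕ} (κ : Fin n → Fin k) where

    colorClass : Fin k → Subset n
    colorClass t = tabulate (λ v → ⌊ κ v ≟ t ⌋)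

    mult : Subset n → Fin k → ℕ
    mult S t = ∣ S ∩ colorClass t ∣

    ‖∩‖ : Subset n → Subset n → ℕ
    ‖∩‖ S S′ = sum (map (λ t → mult S t ⊓ mult S′ t) (allFin k))

    record LinearColoring (Δ : Complex n) : Set where
      field
        surjective : ∀ (t : Fin k) → ∃[ v ] (IsVertex Δ v × κ v ≡ t)
        linear : ∀ F F′ → Facet Δ F → Facet Δ F′ → ‖∩‖ F F′ ≡ ∣ F ∩ F′ ∣

    record Representative (Δ : Complex n) (W : Subset n) : Set where
      field
        W⊆V : ∀ w → w ∈ W → IsVertex Δ w
        each-color : ∀ (t : Fin k) → ∃[ w ] (w ∈ W × κ w ≡ t)
        one-per-color : ∀ w w′ → w ∈ W → w′ ∈ W → κ w ≡ κ w′ → w ≡ w′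
        facets-dominated : ∀ x y → IsVertex Δ x → y ∈ W → κ x ≡ κ y →
                           ∀ F → Facet Δ F → x ∈ F → y ∈ F

  induced : Complex n → Subset n → Complex n
  induced Δ W S = Δ S ∧ ⌊ S ⊆? W ⌋

  data LCReduces (Δ : Complex n) (Δ′ : Complex n) : Set where
    done : Δ ≋ Δ′ → LCReduces Δ Δ′
    step : (k : ℕ) (κ : Fin n → Fin k) (W : Subset n) →
           LinearColoring κ Δ → Representative κ Δ W →
           LCReduces (induced Δ W) Δ′ → LCReduces Δ Δ′

-- A vertex x outside W has a representative y ∈ W with 𝓕(x) ⊆ 𝓕(y), so every face
-- containing x extends by y.  Hence the link of x is a cone with apex y, which is
-- nonevasive, and the star of x collapses away: for a facet F ∋ x the face F ∖ {y}
-- is free, and removing it lowers the number of faces containing x.  Deleting the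
-- vertices outside W one at a time keeps the others dominated by their
-- representatives, so Δ NE-reduces and collapses to the induced subcomplex.

module Submission where

open import Defs
open import Data.Bool using (Bool; true; false; T; _∧_; if_then_else_)
open import Data.Bool.Properties using (T-∧; T-≡; ⇔→≡)
open import Data.Empty using (⊥-elim)
open import Data.Fin using (Fin; _≟_)
open import Data.Fin.Subset using (Subset; _∈_; _∉_; _⊆_; ⁅_⁆; _∪_; _∩_; ∁; Nonempty)
open import Data.Fin.Subset.Properties
  using (_∈?_; _⊆?_; ∉⊥; ⊆-min; ⊆-trans; ⊆-antisym; ∪-identityˡ; p⊆p∪q; q⊆p∪q; p∩q⊆p;
         x∈p∪q⁻; x∈p∩q⁺; x∈p∩q⁻; x∈⁅x⁆; x∈⁅y⁆⇒x≡y; x≢y⇒x∉⁅y⁆; x∉⁅y⁆⇒x≢y; x∉p⇒x∈∁p; x∈∁p⇒x∉p)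
open import Data.List using (List; []; _∷_; allFin)
open import Data.List.Membership.Propositional using () renaming (_∈_ to _∈ₗ_)
open import Data.List.Membership.Propositional.Properties using (∈-allFin)
open import Data.List.Relation.Unary.Any using (here; there)
open import Data.Nat using (ℕ; zero; suc; _+_; _≤_; _<_; z≤n; s≤s)
open import Data.Nat.Induction using (<-wellFounded)
open import Data.Nat.Properties using (≤-refl; +-mono-≤; +-mono-<-≤; +-mono-≤-<)
open import Data.Product using (_×_; _,_; proj₁; proj₂; ∃-syntax; map₂)
open import Data.Sum using (_⊎_; inj₁; inj₂)
open import Data.Unit using (tt)
open import Data.Vec using ([]; _∷_)
open import Function using (_∘_; id)
open import Function.Bundles using (mk⇔; Equivalence)
import Function.Properties.Equivalence as ⇔
open import Induction.WellFounded using (Acc; acc)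
open import Relation.Binary.PropositionalEquality using (_≡_; _≢_; refl; sym; trans; cong; subst)
open import Relation.Nullary using (¬_; Dec; yes; no)
open import Relation.Nullary.Decidable using (⌊_⌋; T?; toWitness; fromWitness; toWitnessFalse; fromWitnessFalse)

private
  variable
    n : ℕ
    Γ Δ Δ′ Δ″ Δ₁ Δ₂ Δ₃ : Complex n
    p q r F G R S W : Subset n
    u v x y : Fin n
    vs : List (Fin n)

∪-⊆ : p ⊆ r → q ⊆ r → p ∪ q ⊆ r
∪-⊆ {p = p} {q = q} p⊆r q⊆r x∈p∪q with x∈p∪q⁻ p q x∈p∪q
... | inj₁ x∈p = p⊆r x∈p
... | inj₂ x∈q = q⊆r x∈q

⁅⁆-⊆ : x ∈ p → ⁅ x ⁆ ⊆ p
⁅⁆-⊆ x∈p y∈⁅x⁆ rewrite x∈⁅y⁆⇒x≡y _ y∈⁅x⁆ = x∈p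

∉-∪-⁅⁆ : x ∉ p → x ≢ y → x ∉ p ∪ ⁅ y ⁆
∉-∪-⁅⁆ {p = p} x∉p x≢y x∈ with x∈p∪q⁻ p _ x∈
... | inj₁ x∈p = x∉p x∈p
... | inj₂ x∈⁅y⁆ = x≢y (x∈⁅y⁆⇒x≡y _ x∈⁅y⁆)

∉⇒≢ : x ∉ p → y ∈ p → x ≢ y
∉⇒≢ x∉p y∈p refl = x∉p y∈p

∈-∩-∁⁅⁆ : x ∈ p → x ≢ y → x ∈ p ∩ ∁ ⁅ y ⁆
∈-∩-∁⁅⁆ x∈p x≢y = x∈p∩q⁺ (x∈p , x∉p⇒x∈∁p (x≢y⇒x∉⁅y⁆ x≢y))

∉-∩-∁⁅⁆ : ∀ p → y ∉ p ∩ ∁ ⁅ y ⁆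
∉-∩-∁⁅⁆ {y = y} p y∈ = x∈∁p⇒x∉p (proj₂ (x∈p∩q⁻ p _ y∈)) (x∈⁅x⁆ y)

-- The complex is explicit below: Agda cannot recover Γ from a type T (Γ S).
∈-del⁺ : ∀ Γ → S ∈Δ Γ → v ∉ S → S ∈Δ del Γ v
∈-del⁺ Γ S∈Γ v∉S = Equivalence.from T-∧ (S∈Γ , fromWitnessFalse v∉S)

∈-del⁻ : ∀ Γ → S ∈Δ del Γ v → S ∈Δ Γ × v ∉ S
∈-del⁻ Γ S∈ = map₂ toWitnessFalse (Equivalence.to T-∧ S∈)

∈-lk⁺ : ∀ Γ → v ∉ S → (S ∪ ⁅ v ⁆) ∈Δ Γ → S ∈Δ lk Γ v
∈-lk⁺ Γ v∉S S+v∈Γ = Equivalence.from T-∧ (fromWitnessFalse v∉S , S+v∈Γ)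

∈-lk⁻ : ∀ Γ → S ∈Δ lk Γ v → v ∉ S × (S ∪ ⁅ v ⁆) ∈Δ Γ
∈-lk⁻ Γ S∈ = let (v∉S , S+v∈Γ) = Equivalence.to T-∧ S∈ in toWitnessFalse v∉S , S+v∈Γ

∈-induced⁺ : ∀ Γ → S ∈Δ Γ → S ⊆ W → S ∈Δ induced Γ W
∈-induced⁺ {S = S} {W = W} _ S∈Γ S⊆W = Equivalence.from T-∧ (S∈Γ , fromWitness {a? = S ⊆? W} S⊆W)

∈-induced⁻ : ∀ Γ → S ∈Δ induced Γ W → S ∈Δ Γ × S ⊆ W
∈-induced⁻ {S = S} {W = W} _ S∈ = map₂ (toWitness {a? = S ⊆? W}) (Equivalence.to T-∧ S∈)

∈-collapse⁺ : ∀ Γ → S ∈Δ Γ → ¬ R ⊆ S → S ∈Δ collapse Γ R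
∈-collapse⁺ Γ S∈Γ R⊈S = Equivalence.from T-∧ (S∈Γ , fromWitnessFalse R⊈S)

∈-collapse⁻ : ∀ Γ → S ∈Δ collapse Γ R → S ∈Δ Γ × ¬ R ⊆ S
∈-collapse⁻ Γ S∈ = map₂ toWitnessFalse (Equivalence.to T-∧ S∈)

isVertex? : (Γ : Complex n) → ∀ v → Dec (IsVertex Γ v)
isVertex? Γ v = T? (Γ ⁅ v ⁆)

≋-intro : (∀ {S} → S ∈Δ Δ → S ∈Δ Δ′) → (∀ {S} → S ∈Δ Δ′ → S ∈Δ Δ) → Δ ≋ Δ′
≋-intro to from S = ⇔→≡ (mk⇔ (Equivalence.to T-≡ ∘ to ∘ Equivalence.from T-≡)
                              (Equivalence.to T-≡ ∘ from ∘ Equivalence.from T-≡))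

≋-sym : Δ ≋ Δ′ → Δ′ ≋ Δ
≋-sym e S = sym (e S)

≋-trans : Δ ≋ Δ′ → Δ′ ≋ Δ″ → Δ ≋ Δ″
≋-trans e e′ S = trans (e S) (e′ S)

∈Δ-resp-≋ : Δ ≋ Δ′ → S ∈Δ Δ → S ∈Δ Δ′
∈Δ-resp-≋ {S = S} e = subst T (e S)

del-cong : Δ ≋ Δ′ → del Δ v ≋ del Δ′ v
del-cong e S = cong (_∧ _) (e S)

lk-cong : Δ ≋ Δ′ → lk Δ v ≋ lk Δ′ v
lk-cong {v = v} e S = cong (_ ∧_) (e (S ∪ ⁅ v ⁆))

collapse-cong : Δ ≋ Δ′ → collapse Δ R ≋ collapse Δ′ R
collapse-cong e S = cong (_∧ _) (e S)

NonEvasive-resp-≋ : Δ ≋ Δ′ → NonEvasive Δ → NonEvasive Δ′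
NonEvasive-resp-≋ e (point (v , faces⇔)) =
  point (v , λ S → ⇔.trans (mk⇔ (∈Δ-resp-≋ (≋-sym e)) (∈Δ-resp-≋ e)) (faces⇔ S))
NonEvasive-resp-≋ e (step v v∈Δ d l) =
  step v (∈Δ-resp-≋ e v∈Δ) (NonEvasive-resp-≋ (del-cong e) d) (NonEvasive-resp-≋ (lk-cong e) l)

NEReduces-respˡ-≋ : Δ₁ ≋ Δ₂ → NEReduces Δ₁ Δ′ → NEReduces Δ₂ Δ′
NEReduces-respˡ-≋ e (done e′) = done (≋-trans (≋-sym e) e′)
NEReduces-respˡ-≋ e (step v v∈Δ l r) =
  step v (∈Δ-resp-≋ e v∈Δ) (NonEvasive-resp-≋ (lk-cong e) l) (NEReduces-respˡ-≋ (del-cong e) r)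

NEReduces-respʳ-≋ : Δ₂ ≋ Δ₃ → NEReduces Δ Δ₂ → NEReduces Δ Δ₃
NEReduces-respʳ-≋ e (done e′) = done (≋-trans e′ e)
NEReduces-respʳ-≋ e (step v v∈Δ l r) = step v v∈Δ l (NEReduces-respʳ-≋ e r)

NEReduces-trans : NEReduces Δ₁ Δ₂ → NEReduces Δ₂ Δ₃ → NEReduces Δ₁ Δ₃
NEReduces-trans (done e) r′ = NEReduces-respˡ-≋ (≋-sym e) r′
NEReduces-trans (step v v∈Δ l r) r′ = step v v∈Δ l (NEReduces-trans r r′)

Facet-resp-≋ : Δ ≋ Δ′ → Facet Δ F → Facet Δ′ F
Facet-resp-≋ e (F∈Δ , F-max) = ∈Δ-resp-≋ e F∈Δ , λ G G∈Δ′ → F-max G (∈Δ-resp-≋ (≋-sym e) G∈Δ′)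

Free-resp-≋ : Δ ≋ Δ′ → Free Δ R → Free Δ′ R
Free-resp-≋ e (R∈Δ , ¬facet , F , facet , R⊆F , unique) =
  ∈Δ-resp-≋ e R∈Δ , ¬facet ∘ Facet-resp-≋ (≋-sym e) ,
  F , Facet-resp-≋ e facet , R⊆F , λ G → unique G ∘ Facet-resp-≋ (≋-sym e)

Collapses-respˡ-≋ : Δ₁ ≋ Δ₂ → Collapses Δ₁ Δ′ → Collapses Δ₂ Δ′
Collapses-respˡ-≋ e (done e′) = done (≋-trans (≋-sym e) e′)
Collapses-respˡ-≋ e (step R free c) = step R (Free-resp-≋ e free) (Collapses-respˡ-≋ (collapse-cong e) c)

Collapses-respʳ-≋ : Δ₂ ≋ Δ₃ → Collapses Δ Δ₂ → Collapses Δ Δ₃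
Collapses-respʳ-≋ e (done e′) = done (≋-trans e′ e)
Collapses-respʳ-≋ e (step R free c) = step R free (Collapses-respʳ-≋ e c)

Collapses-trans : Collapses Δ₁ Δ₂ → Collapses Δ₂ Δ₃ → Collapses Δ₁ Δ₃
Collapses-trans (done e) c′ = Collapses-respˡ-≋ (≋-sym e) c′
Collapses-trans (step R free c) c′ = step R free (Collapses-trans c c′)

module _ (c : IsComplex Γ) where
  open IsComplex c

  face-vertex : S ∈Δ Γ → v ∈ S → IsVertex Γ v
  face-vertex S∈Γ v∈S = down-closed (⁅⁆-⊆ v∈S) S∈Γ

  lk-vertex : IsVertex (lk Γ v) x → IsVertex Γ x
  lk-vertex x∈lk = down-closed (p⊆p∪q _) (proj₂ (∈-lk⁻ Γ x∈lk))

  del-isComplex : ∀ v → IsComplex (del Γ v)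
  del-isComplex v = record
    { empty-face = ∈-del⁺ Γ empty-face ∉⊥
    ; down-closed = λ S⊆S′ S′∈ → let (S′∈Γ , v∉S′) = ∈-del⁻ Γ S′∈ in
        ∈-del⁺ Γ (down-closed S⊆S′ S′∈Γ) (v∉S′ ∘ S⊆S′) }

  lk-isComplex : IsVertex Γ v → IsComplex (lk Γ v)
  lk-isComplex v∈Γ = record
    { empty-face = ∈-lk⁺ Γ ∉⊥ (down-closed (∪-⊆ (⊆-min _) id) v∈Γ)
    ; down-closed = λ S⊆S′ S′∈ → let (v∉S′ , S′+v∈Γ) = ∈-lk⁻ Γ S′∈ in
        ∈-lk⁺ Γ (v∉S′ ∘ S⊆S′) (down-closed (∪-⊆ (p⊆p∪q _ ∘ S⊆S′) (q⊆p∪q _ _)) S′+v∈Γ) }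

  induced-isComplex : ∀ W → IsComplex (induced Γ W)
  induced-isComplex W = record
    { empty-face = ∈-induced⁺ Γ empty-face (⊆-min _)
    ; down-closed = λ S⊆S′ S′∈ → let (S′∈Γ , S′⊆W) = ∈-induced⁻ Γ S′∈ in
        ∈-induced⁺ Γ (down-closed S⊆S′ S′∈Γ) (S′⊆W ∘ S⊆S′) }

  collapse-isComplex : Nonempty R → IsComplex (collapse Γ R)
  collapse-isComplex (x , x∈R) = record
    { empty-face = ∈-collapse⁺ Γ empty-face (λ R⊆⊥ → ∉⊥ (R⊆⊥ x∈R))
    ; down-closed = λ S⊆S′ S′∈ → let (S′∈Γ , R⊈S′) = ∈-collapse⁻ Γ S′∈ in
        ∈-collapse⁺ Γ (down-closed S⊆S′ S′∈Γ) (λ R⊆S → R⊈S′ (⊆-trans R⊆S S⊆S′)) }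

module _ {Γ : Complex n} (c : IsComplex Γ) where
  open IsComplex c

  extend : List (Fin n) → Subset n → Subset n
  extend [] S = S
  extend (v ∷ vs) S with T? (Γ (S ∪ ⁅ v ⁆))
  ... | yes _ = extend vs (S ∪ ⁅ v ⁆)
  ... | no _ = extend vs S

  extend-∈Δ : ∀ vs → S ∈Δ Γ → extend vs S ∈Δ Γ
  extend-∈Δ [] S∈Γ = S∈Γ
  extend-∈Δ {S = S} (v ∷ vs) S∈Γ with T? (Γ (S ∪ ⁅ v ⁆))
  ... | yes S+v∈Γ = extend-∈Δ vs S+v∈Γ
  ... | no _ = extend-∈Δ vs S∈Γ

  ⊆-extend : ∀ vs → S ⊆ extend vs S
  ⊆-extend [] = id
  ⊆-extend {S = S} (v ∷ vs) with T? (Γ (S ∪ ⁅ v ⁆))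
  ... | yes _ = ⊆-extend vs ∘ p⊆p∪q _
  ... | no _ = ⊆-extend vs

  extend-maximal : ∀ vs → v ∈ₗ vs → G ∈Δ Γ → extend vs S ⊆ G → v ∈ G → v ∈ extend vs S
  extend-maximal {S = S} (u ∷ vs) (here refl) G∈Γ ext⊆G u∈G with T? (Γ (S ∪ ⁅ u ⁆))
  ... | yes _ = ⊆-extend vs (q⊆p∪q S _ (x∈⁅x⁆ u))
  ... | no S+u∉Γ = ⊥-elim (S+u∉Γ (down-closed (∪-⊆ (ext⊆G ∘ ⊆-extend vs) (⁅⁆-⊆ u∈G)) G∈Γ))
  extend-maximal {S = S} (u ∷ vs) (there v∈vs) G∈Γ ext⊆G v∈G with T? (Γ (S ∪ ⁅ u ⁆))
  ... | yes _ = extend-maximal vs v∈vs G∈Γ ext⊆G v∈G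
  ... | no _ = extend-maximal vs v∈vs G∈Γ ext⊆G v∈G

  facet-⊇ : S ∈Δ Γ → ∃[ F ] (Facet Γ F × S ⊆ F)
  facet-⊇ {S = S} S∈Γ = extend (allFin n) S , (extend-∈Δ (allFin n) S∈Γ , maximal) , ⊆-extend (allFin n)
    where
    maximal : ∀ G → G ∈Δ Γ → extend (allFin n) S ⊆ G → G ≡ extend (allFin n) S
    maximal G G∈Γ F⊆G = ⊆-antisym (λ v∈G → extend-maximal (allFin n) (∈-allFin _) G∈Γ F⊆G v∈G) F⊆G

∪-⁅⁆-swap : (p ∪ ⁅ x ⁆) ∪ ⁅ y ⁆ ⊆ (p ∪ ⁅ y ⁆) ∪ ⁅ x ⁆
∪-⁅⁆-swap = ∪-⊆ (∪-⊆ (p⊆p∪q _ ∘ p⊆p∪q _) (q⊆p∪q _ _)) (p⊆p∪q _ ∘ q⊆p∪q _ _)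

Dominated : Complex n → Fin n → Fin n → Set
Dominated Γ x y = ∀ {S} → S ∈Δ Γ → x ∈ S → (S ∪ ⁅ y ⁆) ∈Δ Γ

Apex : Complex n → Fin n → Set
Apex Γ y = ∀ {S} → S ∈Δ Γ → (S ∪ ⁅ y ⁆) ∈Δ Γ

dominated-facet : ∀ Γ → Dominated Γ x y → Facet Γ F → x ∈ F → y ∈ F
dominated-facet {y = y} {F = F} Γ d (F∈Γ , F-max) x∈F =
  subst (y ∈_) (F-max _ (d F∈Γ x∈F) (p⊆p∪q _)) (q⊆p∪q F _ (x∈⁅x⁆ y))

del-dominated : ∀ Γ → u ≢ y → Dominated Γ x y → Dominated (del Γ u) x y
del-dominated Γ u≢y d S∈del x∈S =
  let (S∈Γ , u∉S) = ∈-del⁻ Γ S∈del in ∈-del⁺ Γ (d S∈Γ x∈S) (∉-∪-⁅⁆ u∉S u≢y)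

del-apex : ∀ Γ → u ≢ y → Apex Γ y → Apex (del Γ u) y
del-apex Γ u≢y a S∈del =
  let (S∈Γ , u∉S) = ∈-del⁻ Γ S∈del in ∈-del⁺ Γ (a S∈Γ) (∉-∪-⁅⁆ u∉S u≢y)

module _ (c : IsComplex Γ) where
  open IsComplex c

  facets-dominated⇒dominated : (∀ {F} → Facet Γ F → x ∈ F → y ∈ F) → Dominated Γ x y
  facets-dominated⇒dominated y∈facets S∈Γ x∈S =
    let (F , facet , S⊆F) = facet-⊇ c S∈Γ in
    down-closed (∪-⊆ S⊆F (⁅⁆-⊆ (y∈facets facet (S⊆F x∈S)))) (proj₁ facet)

  apex-isVertex : Apex Γ y → IsVertex Γ y
  apex-isVertex a = subst (T ∘ Γ) (∪-identityˡ _) (a empty-face)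

  lk-apex : u ≢ y → Dominated Γ u y → Apex (lk Γ u) y
  lk-apex u≢y d S∈lk =
    let (u∉S , S+u∈Γ) = ∈-lk⁻ Γ S∈lk in
    ∈-lk⁺ Γ (∉-∪-⁅⁆ u∉S u≢y) (down-closed ∪-⁅⁆-swap (d S+u∈Γ (q⊆p∪q _ _ (x∈⁅x⁆ _))))

EnumeratesOutside : Subset n → List (Fin n) → Complex n → Set
EnumeratesOutside W vs Γ = ∀ {x} → IsVertex Γ x → x ∉ W → x ∈ₗ vs

enumeratesOutside-∷ : ∀ Γ Δ → (∀ {x} → IsVertex Δ x → IsVertex Γ x) → v ∈ W ⊎ ¬ IsVertex Δ v →
                      EnumeratesOutside W (v ∷ vs) Γ → EnumeratesOutside W vs Δ
enumeratesOutside-∷ Γ Δ Δ⊆Γ skip enum x∈Δ x∉W with enum (Δ⊆Γ x∈Δ) x∉W | skip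
... | there x∈vs | _ = x∈vs
... | here refl | inj₁ v∈W = ⊥-elim (x∉W v∈W)
... | here refl | inj₂ v∉Δ = ⊥-elim (v∉Δ x∈Δ)

enumeratesOutside-skip : ∀ Γ → v ∈ W ⊎ ¬ IsVertex Γ v → EnumeratesOutside W (v ∷ vs) Γ → EnumeratesOutside W vs Γ
enumeratesOutside-skip Γ = enumeratesOutside-∷ Γ Γ id

enumeratesOutside-del : ∀ Γ → EnumeratesOutside W (v ∷ vs) Γ → EnumeratesOutside W vs (del Γ v)
enumeratesOutside-del {v = v} Γ =
  enumeratesOutside-∷ Γ (del Γ v) (proj₁ ∘ ∈-del⁻ Γ) (inj₂ λ v∈del → proj₂ (∈-del⁻ Γ v∈del) (x∈⁅x⁆ v))

enumeratesOutside-lk : IsComplex Γ → EnumeratesOutside W (v ∷ vs) Γ → EnumeratesOutside W vs (lk Γ v)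
enumeratesOutside-lk {Γ = Γ} {v = v} c =
  enumeratesOutside-∷ Γ (lk Γ v) (lk-vertex c) (inj₂ λ v∈lk → proj₁ (∈-lk⁻ Γ v∈lk) (x∈⁅x⁆ v))

enumeratesOutside-[]-⊆ : IsComplex Γ → EnumeratesOutside W [] Γ → S ∈Δ Γ → S ⊆ W
enumeratesOutside-[]-⊆ {W = W} c enum S∈Γ {v} v∈S with v ∈? W
... | yes v∈W = v∈W
... | no v∉W with enum (face-vertex c S∈Γ v∈S) v∉W
... | ()

apex-nonEvasive : ∀ vs → IsComplex Γ → Apex Γ y → EnumeratesOutside ⁅ y ⁆ vs Γ → NonEvasive Γ
apex-nonEvasive {y = y} [] c a enum =
  point (y , λ S → mk⇔ (enumeratesOutside-[]-⊆ c enum) (λ S⊆y → IsComplex.down-closed c S⊆y (apex-isVertex c a)))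
apex-nonEvasive {Γ = Γ} {y = y} (u ∷ vs) c a enum with u ∈? ⁅ y ⁆ | isVertex? Γ u
... | yes u∈y | _ = apex-nonEvasive vs c a (enumeratesOutside-skip Γ (inj₁ u∈y) enum)
... | no _ | no u∉Γ = apex-nonEvasive vs c a (enumeratesOutside-skip Γ (inj₂ u∉Γ) enum)
... | no u∉y | yes u∈Γ =
  step u u∈Γ
    (apex-nonEvasive vs (del-isComplex c u) (del-apex Γ u≢y a) (enumeratesOutside-del Γ enum))
    (apex-nonEvasive vs (lk-isComplex c u∈Γ) (lk-apex c u≢y (λ S∈Γ _ → a S∈Γ)) (enumeratesOutside-lk c enum))
  where
  u≢y : u ≢ y
  u≢y = x∉⁅y⁆⇒x≢y u∉y

countSubsets : (Subset n → Bool) → ℕ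
countSubsets {n = zero} P = if P [] then 1 else 0
countSubsets {n = suc n} P = countSubsets (P ∘ (true ∷_)) + countSubsets (P ∘ (false ∷_))

countSubsets-mono : {P Q : Subset n → Bool} → (∀ {S} → T (Q S) → T (P S)) → countSubsets Q ≤ countSubsets P
countSubsets-mono {n = zero} {P} {Q} Q⇒P with Q [] | P [] | Q⇒P {[]}
... | false | _ | _ = z≤n
... | true | true | _ = ≤-refl
... | true | false | Q⇒P[] = ⊥-elim (Q⇒P[] tt)
countSubsets-mono {n = suc n} {P} {Q} Q⇒P =
  +-mono-≤ (countSubsets-mono {P = P ∘ (true ∷_)} {Q ∘ (true ∷_)} Q⇒P)
           (countSubsets-mono {P = P ∘ (false ∷_)} {Q ∘ (false ∷_)} Q⇒P)

countSubsets-strict : {P Q : Subset n → Bool} → (∀ {S} → T (Q S) → T (P S)) →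
                      T (P S) → ¬ T (Q S) → countSubsets Q < countSubsets P
countSubsets-strict {n = zero} {S = []} {P} {Q} _ PS ¬QS with Q [] | P []
... | false | true = s≤s z≤n
... | true | _ = ⊥-elim (¬QS tt)
... | false | false = ⊥-elim PS
countSubsets-strict {n = suc n} {S = true ∷ S} {P} {Q} Q⇒P PS ¬QS =
  +-mono-<-≤ (countSubsets-strict {P = P ∘ (true ∷_)} {Q ∘ (true ∷_)} Q⇒P PS ¬QS)
             (countSubsets-mono {P = P ∘ (false ∷_)} {Q ∘ (false ∷_)} Q⇒P)
countSubsets-strict {n = suc n} {S = false ∷ S} {P} {Q} Q⇒P PS ¬QS =
  +-mono-≤-< (countSubsets-mono {P = P ∘ (true ∷_)} {Q ∘ (true ∷_)} Q⇒P)
             (countSubsets-strict {P = P ∘ (false ∷_)} {Q ∘ (false ∷_)} Q⇒P PS ¬QS)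

⊆-∪-⁅⁆⇒⊆ : y ∉ p → p ⊆ q ∪ ⁅ y ⁆ → p ⊆ q
⊆-∪-⁅⁆⇒⊆ {q = q} y∉p p⊆q+y v∈p with x∈p∪q⁻ q _ (p⊆q+y v∈p)
... | inj₁ v∈q = v∈q
... | inj₂ v∈⁅y⁆ rewrite x∈⁅y⁆⇒x≡y _ v∈⁅y⁆ = ⊥-elim (y∉p v∈p)

starSize : Complex n → Fin n → ℕ
starSize Γ x = countSubsets (λ S → Γ S ∧ ⌊ x ∈? S ⌋)

starSize-collapse : ∀ Γ → x ∈ R → R ⊆ F → F ∈Δ Γ → starSize (collapse Γ R) x < starSize Γ x
starSize-collapse {x = x} {R = R} {F = F} Γ x∈R R⊆F F∈Γ =
  countSubsets-strict {S = F} star′⇒star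
    (Equivalence.from T-∧ (F∈Γ , fromWitness (R⊆F x∈R)))
    (λ F∈star′ → proj₂ (∈-collapse⁻ Γ (proj₁ (Equivalence.to T-∧ F∈star′))) R⊆F)
  where
  star′⇒star : ∀ {S} → T (collapse Γ R S ∧ ⌊ x ∈? S ⌋) → T (Γ S ∧ ⌊ x ∈? S ⌋)
  star′⇒star S∈star′ =
    let (S∈Γ′ , x∈S) = Equivalence.to T-∧ S∈star′ in Equivalence.from T-∧ (proj₁ (∈-collapse⁻ Γ S∈Γ′) , x∈S)

collapse-dominated : ∀ Γ → y ∉ R → Dominated Γ x y → Dominated (collapse Γ R) x y
collapse-dominated Γ y∉R d S∈Γ′ x∈S =
  let (S∈Γ , R⊈S) = ∈-collapse⁻ Γ S∈Γ′ in ∈-collapse⁺ Γ (d S∈Γ x∈S) (R⊈S ∘ ⊆-∪-⁅⁆⇒⊆ y∉R)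

del-collapse : ∀ Γ → x ∈ R → del (collapse Γ R) x ≋ del Γ x
del-collapse {R = R} Γ x∈R = ≋-intro
  (λ S∈ → let (S∈Γ′ , x∉S) = ∈-del⁻ (collapse Γ R) S∈ in ∈-del⁺ Γ (proj₁ (∈-collapse⁻ Γ S∈Γ′)) x∉S)
  (λ S∈ → let (S∈Γ , x∉S) = ∈-del⁻ Γ S∈ in ∈-del⁺ (collapse Γ R) (∈-collapse⁺ Γ S∈Γ (λ R⊆S → x∉S (R⊆S x∈R))) x∉S)

module _ (c : IsComplex Γ) (x≢y : x ≢ y) (d : Dominated Γ x y) where
  open IsComplex c

  dominated-free : Facet Γ F → x ∈ F → Free Γ (F ∩ ∁ ⁅ y ⁆)
  dominated-free {F = F} facet@(F∈Γ , F-max) x∈F = R∈Γ , ¬facet , F , facet , R⊆F , unique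
    where
    R⊆F : F ∩ ∁ ⁅ y ⁆ ⊆ F
    R⊆F = p∩q⊆p F _
    R∈Γ : (F ∩ ∁ ⁅ y ⁆) ∈Δ Γ
    R∈Γ = down-closed R⊆F F∈Γ
    ¬facet : ¬ Facet Γ (F ∩ ∁ ⁅ y ⁆)
    ¬facet (_ , R-max) = ∉-∩-∁⁅⁆ F (subst (y ∈_) (R-max F F∈Γ R⊆F) (dominated-facet Γ d facet x∈F))
    unique : ∀ G → Facet Γ G → F ∩ ∁ ⁅ y ⁆ ⊆ G → G ≡ F
    unique G G-facet R⊆G = F-max G (proj₁ G-facet) F⊆G
      where
      F⊆G : F ⊆ G
      F⊆G {v} v∈F with v ≟ y
      ... | yes refl = dominated-facet Γ d G-facet (R⊆G (∈-∩-∁⁅⁆ x∈F x≢y))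
      ... | no v≢y = R⊆G (∈-∩-∁⁅⁆ v∈F v≢y)

dominated⇒collapses-del : IsComplex Γ → x ≢ y → Dominated Γ x y → Collapses Γ (del Γ x)
dominated⇒collapses-del {x = x} {y = y} c x≢y d = go (<-wellFounded _) c d
  where
  go : ∀ {Γ} → Acc _<_ (starSize Γ x) → IsComplex Γ → Dominated Γ x y → Collapses Γ (del Γ x)
  go {Γ} (acc smaller) c d with isVertex? Γ x
  ... | no x∉Γ = done (≋-intro (λ S∈Γ → ∈-del⁺ Γ S∈Γ (x∉Γ ∘ face-vertex c S∈Γ)) (proj₁ ∘ ∈-del⁻ Γ))
  ... | yes x∈Γ with facet-⊇ c x∈Γ
  ...   | F , facet , x⊆F =
    step (F ∩ ∁ ⁅ y ⁆) (dominated-free c x≢y d facet x∈F)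
      (Collapses-respʳ-≋ (del-collapse Γ x∈R)
        (go (smaller (starSize-collapse Γ x∈R (p∩q⊆p F _) (proj₁ facet)))
            (collapse-isComplex c (x , x∈R)) (collapse-dominated Γ (∉-∩-∁⁅⁆ F) d)))
    where
    x∈F : x ∈ F
    x∈F = x⊆F (x∈⁅x⁆ x)
    x∈R : x ∈ F ∩ ∁ ⁅ y ⁆
    x∈R = ∈-∩-∁⁅⁆ x∈F x≢y

DominatedOutside : Subset n → Complex n → Set
DominatedOutside W Γ = ∀ {x} → IsVertex Γ x → x ∉ W → ∃[ y ] (y ∈ W × Dominated Γ x y)

del-dominatedOutside : ∀ Γ → v ∉ W → DominatedOutside W Γ → DominatedOutside W (del Γ v)
del-dominatedOutside Γ v∉W dom x∈del x∉W =
  let (y , y∈W , d) = dom (proj₁ (∈-del⁻ Γ x∈del)) x∉W in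
  y , y∈W , del-dominated Γ (∉⇒≢ v∉W y∈W) d

induced-del : ∀ Γ → v ∉ W → induced (del Γ v) W ≋ induced Γ W
induced-del {v = v} Γ v∉W = ≋-intro
  (λ S∈ → let (S∈del , S⊆W) = ∈-induced⁻ (del Γ v) S∈ in ∈-induced⁺ Γ (proj₁ (∈-del⁻ Γ S∈del)) S⊆W)
  (λ S∈ → let (S∈Γ , S⊆W) = ∈-induced⁻ Γ S∈ in ∈-induced⁺ (del Γ v) (∈-del⁺ Γ S∈Γ (v∉W ∘ S⊆W)) S⊆W)

reduce-to-induced : ∀ vs → IsComplex Γ → DominatedOutside W Γ → EnumeratesOutside W vs Γ →
                    NEReduces Γ (induced Γ W) × Collapses Γ (induced Γ W)
reduce-to-induced {Γ = Γ} {W = W} [] c dom enum = done Γ≋ , done Γ≋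
  where
  Γ≋ : Γ ≋ induced Γ W
  Γ≋ = ≋-intro (λ S∈Γ → ∈-induced⁺ Γ S∈Γ (enumeratesOutside-[]-⊆ c enum S∈Γ)) (proj₁ ∘ ∈-induced⁻ Γ)
reduce-to-induced {Γ = Γ} {W = W} (v ∷ vs) c dom enum with v ∈? W | isVertex? Γ v
... | yes v∈W | _ = reduce-to-induced vs c dom (enumeratesOutside-skip Γ (inj₁ v∈W) enum)
... | no _ | no v∉Γ = reduce-to-induced vs c dom (enumeratesOutside-skip Γ (inj₂ v∉Γ) enum)
... | no v∉W | yes v∈Γ
    with dom v∈Γ v∉W
       | reduce-to-induced vs (del-isComplex c v) (del-dominatedOutside Γ v∉W dom) (enumeratesOutside-del Γ enum)
...   | y , y∈W , d | ne , co =
  step v v∈Γ (apex-nonEvasive (allFin _) (lk-isComplex c v∈Γ) (lk-apex c v≢y d) (λ {u} _ _ → ∈-allFin u))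
             (NEReduces-respʳ-≋ (induced-del Γ v∉W) ne) ,
  Collapses-trans (dominated⇒collapses-del c v≢y d) (Collapses-respʳ-≋ (induced-del Γ v∉W) co)
  where
  v≢y : v ≢ y
  v≢y = ∉⇒≢ v∉W y∈W

module _ {k} {κ : Fin n → Fin k} (c : IsComplex Δ) (rep : Representative κ Δ W) where
  open Representative rep

  representative⇒dominatedOutside : DominatedOutside W Δ
  representative⇒dominatedOutside {x} x∈Δ _ =
    let (y , y∈W , κy≡κx) = each-color (κ x) in
    y , y∈W , facets-dominated⇒dominated c (λ {F} facet → facets-dominated x y x∈Δ y∈W (sym κy≡κx) F facet)

  representative-reduces : NEReduces Δ (induced Δ W) × Collapses Δ (induced Δ W)
  representative-reduces =
    reduce-to-induced (allFin _) c representative⇒dominatedOutside (λ {x} _ _ → ∈-allFin x)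

lcReduces⇒neReduces×collapses : IsComplex Δ → LCReduces Δ Δ′ → NEReduces Δ Δ′ × Collapses Δ Δ′
lcReduces⇒neReduces×collapses c (done Δ≋Δ′) = done Δ≋Δ′ , done Δ≋Δ′
lcReduces⇒neReduces×collapses c (step _ _ W _ rep r) =
  let (ne₁ , co₁) = representative-reduces c rep
      (ne₂ , co₂) = lcReduces⇒neReduces×collapses (induced-isComplex c W) r
  in NEReduces-trans ne₁ ne₂ , Collapses-trans co₁ co₂

theorem1p2 : ∀ (n : ℕ) (Δ Δ′ : Complex n) → IsComplex Δ → IsComplex Δ′ →
    Δ′ ⊑ Δ → LCReduces Δ Δ′ → NEReduces Δ Δ′ × Collapses Δ Δ′
theorem1p2 n Δ Δ′ c _ _ = lcReduces⇒neReduces×collapses c
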